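{- For any tree $T$, $\mathrm{width}(T) \cdot\left(\ln \mathrm{width}(T)+\ln\ln \mathrm{width}(T)\right) = O(\#T)$.
   Context: Trees are unordered rooted trees; two trees are isomorphic if one can be obtained from the other by permuting children of nodes. The depth of a node is the length of the path from the root to it, $\mathrm{depth}(T)$ is the maximal depth of nodes of $T$, the level of a node $u$ is $\mathrm{depth}(T)-(\text{depth of }u)$, and $T^d$ denotes the set of nodes of level $d$. $\mathrm{width}(T)$ is the maximum, over $d\in[\![0,\mathrm{depth}(T)]\!]$, of the number of pairwise non-isomorphic subtrees rooted at the nodes of $T^d$ (i.e. the number of distinct colours assigned at level $d$ by the AHU-type colouring). $\ln$ is the natural logarithm. -}

module Defs where

open import Data.Nat using (ℕ; zero; suc; _+_; _*_; _∸_; _⊔_; _≤_)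
open import Data.Nat.Logarithm using (⌊log₂_⌋)
open import Data.List using (List; []; _∷_; _++_; length)
open import Data.List.Relation.Binary.Permutation.Propositional using (_↭_)
open import Data.List.Relation.Binary.Pointwise using (Pointwise)
open import Data.List.Relation.Unary.All using (All)
open import Data.List.Relation.Unary.Any using (Any)
open import Data.List.Relation.Unary.AllPairs using (AllPairs)
open import Data.List.Membership.Propositional using (_∈_)
open import Data.Product using (Σ; ∃; _×_)
open import Relation.Nullary using (¬_)
open import Relation.Binary.PropositionalEquality using (_≡_)

-- Finite rooted trees; a node is given by the list of its children.
-- Unordered trees are handled via the isomorphism relation _≅_ below.
data Tree : Set where
  node : List Tree → Tree

data _≅_ : Tree → Tree → Set where
  iso : ∀ {ts us vs} → ts ↭ vs → Pointwise _≅_ vs us → node ts ≅ node us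

mutual
  size : Tree → ℕ
  size (node ts) = suc (sizes ts)

  sizes : List Tree → ℕ
  sizes [] = 0
  sizes (t ∷ ts) = size t + sizes ts

mutual
  depth : Tree → ℕ
  depth (node []) = 0
  depth (node (t ∷ ts)) = suc (depths (t ∷ ts))

  depths : List Tree → ℕ
  depths [] = 0
  depths (t ∷ ts) = depth t ⊔ depths ts

mutual
  atDepth : ℕ → Tree → List Tree
  atDepth zero t = t ∷ []
  atDepth (suc k) (node ts) = atDepths k ts

  atDepths : ℕ → List Tree → List Tree
  atDepths k [] = []
  atDepths k (t ∷ ts) = atDepth k t ++ atDepths k ts

-- subtrees rooted at the nodes of T^d (level d = depth(T) - depth of node)
atLevel : ℕ → Tree → List Tree
atLevel d T = atDepth (depth T ∸ d) T

-- NumClasses L k : the list L of trees has exactly k isomorphism classes,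
-- i.e. there are k pairwise non-isomorphic representatives taken from L
-- such that every element of L is isomorphic to one of them.
NumClasses : List Tree → ℕ → Set
NumClasses L k =
  Σ (List Tree) λ R →
    length R ≡ k × All (_∈ L) R × AllPairs (λ s t → ¬ (s ≅ t)) R
      × All (λ t → Any (t ≅_) R) L

Width : Tree → ℕ → Set
Width T w =
  (Σ ℕ λ d → d ≤ depth T × NumClasses (atLevel d T) w)
  × (∀ d k → d ≤ depth T → NumClasses (atLevel d T) k → k ≤ w)

wlogw : ℕ → ℕ
wlogw w = w * (⌊log₂ w ⌋ + ⌊log₂ ⌊log₂ w ⌋ ⌋)

-- Pairwise non-isomorphic subtrees rooted at one level of T are disjoint, so if there
-- are w of them their sizes add up to at most #T. Writing each as a balanced-parenthesis
-- bit string of length 2·size gives w distinct bit strings of total length ≤ 2·#T.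
-- Among distinct bit strings at most 2^k are shorter than k, so their total length is
-- at least k·(w − 2^k); taking k = ⌊log₂ w⌋ − 1 yields w·⌊log₂ w⌋ ≤ 5·#T. The
-- log log term is dominated by the log term, which only costs another factor 2.
module Submission where

open import Defs
open import Data.Nat using (ℕ; _*_; _≤_)
open import Data.Product using (Σ)

open import Data.Nat using (zero; suc; _+_; _∸_; _^_; _<_; z≤n; s≤s; ⌊_/2⌋; ⌈_/2⌉)
open import Data.Nat.Properties hiding (_≟_)
open import Data.Nat.ListAction using (sum)
open import Data.Nat.Logarithm using (⌊log₂_⌋; ⌊log₂⌋-mono-≤; ⌊log₂[2^n]⌋≡n; ⌊log₂⌊n/2⌋⌋≡⌊log₂n⌋∸1)
open import Data.Nat.Tactic.RingSolver using (solve-∀)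
open import Algebra.Properties.CommutativeSemigroup +-commutativeSemigroup using (x∙yz≈y∙xz)
open import Data.Bool using (Bool; true; false)
open import Data.Bool.Properties using (_≟_)
open import Data.List using (List; []; _∷_; _++_; length; map)
open import Data.List.Properties using (length-map; ∷-injectiveʳ)
open import Data.List.Relation.Unary.All using (All; []; _∷_)
open import Data.List.Relation.Unary.Any using (here; there)
import Data.List.Relation.Unary.AllPairs as AllPairs
open import Data.List.Relation.Unary.Unique.Propositional using (Unique; []; _∷_)
import Data.List.Relation.Unary.Unique.Propositional.Properties as Unique
open import Data.List.Relation.Binary.Pointwise using (Pointwise; []; _∷_)
open import Data.List.Relation.Binary.Permutation.Propositional using (↭-refl)
open import Data.List.Membership.Propositional using (_∈_)
open import Data.List.Membership.Propositional.Properties using (∈-∃++; ∈-++⁻; ∈-++⁺ˡ; ∈-++⁺ʳ)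
open import Data.Product using (_×_; _,_; proj₁)
open import Data.Sum using (inj₁; inj₂)
open import Data.Empty using (⊥-elim)
open import Relation.Nullary using (¬_; yes; no)
open import Relation.Binary.PropositionalEquality
  using (_≡_; _≢_; refl; sym; trans; cong; cong₂; subst; module ≡-Reasoning)

mutual
  ≅-refl : ∀ t → t ≅ t
  ≅-refl (node ts) = iso ↭-refl (≅-refl-pointwise ts)

  ≅-refl-pointwise : ∀ ts → Pointwise _≅_ ts ts
  ≅-refl-pointwise [] = []
  ≅-refl-pointwise (t ∷ ts) = ≅-refl t ∷ ≅-refl-pointwise ts

≇⇒≢ : ∀ {s t} → ¬ (s ≅ t) → s ≢ t
≇⇒≢ {s} s≇t refl = s≇t (≅-refl s)

sizes-++ : ∀ ts us → sizes (ts ++ us) ≡ sizes ts + sizes us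
sizes-++ [] us = refl
sizes-++ (t ∷ ts) us = trans (cong (size t +_) (sizes-++ ts us)) (sym (+-assoc (size t) _ _))

mutual
  sizes-atDepth≤size : ∀ k t → sizes (atDepth k t) ≤ size t
  sizes-atDepth≤size zero t = ≤-reflexive (+-identityʳ (size t))
  sizes-atDepth≤size (suc k) (node ts) = m≤n⇒m≤1+n (sizes-atDepths≤sizes k ts)

  sizes-atDepths≤sizes : ∀ k ts → sizes (atDepths k ts) ≤ sizes ts
  sizes-atDepths≤sizes k [] = z≤n
  sizes-atDepths≤sizes k (t ∷ ts) = begin
    sizes (atDepth k t ++ atDepths k ts)        ≡⟨ sizes-++ (atDepth k t) (atDepths k ts) ⟩
    sizes (atDepth k t) + sizes (atDepths k ts) ≤⟨ +-mono-≤ (sizes-atDepth≤size k t) (sizes-atDepths≤sizes k ts) ⟩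
    size t + sizes ts                           ∎
    where open ≤-Reasoning

length≤sizes : ∀ ts → length ts ≤ sizes ts
length≤sizes [] = z≤n
length≤sizes (node _ ∷ ts) = s≤s (≤-trans (length≤sizes ts) (m≤n+m _ _))

unique-⊆⇒sizes≤ : ∀ ts us → Unique ts → All (_∈ us) ts → sizes ts ≤ sizes us
unique-⊆⇒sizes≤ [] us _ _ = z≤n
unique-⊆⇒sizes≤ (t ∷ ts) us (t∉ts ∷ ts!) (t∈us ∷ ts⊆us) with ∈-∃++ t∈us
... | vs , ws , refl = begin
    size t + sizes ts              ≤⟨ +-monoʳ-≤ (size t) (unique-⊆⇒sizes≤ ts (vs ++ ws) ts! (remove-t ts t∉ts ts⊆us)) ⟩
    size t + sizes (vs ++ ws)      ≡⟨ cong (size t +_) (sizes-++ vs ws) ⟩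
    size t + (sizes vs + sizes ws) ≡⟨ x∙yz≈y∙xz (size t) (sizes vs) (sizes ws) ⟩
    sizes vs + (size t + sizes ws) ≡⟨ sym (sizes-++ vs (t ∷ ws)) ⟩
    sizes (vs ++ t ∷ ws)           ∎
  where
  open ≤-Reasoning
  remove-t : ∀ ts → All (t ≢_) ts → All (_∈ vs ++ t ∷ ws) ts → All (_∈ vs ++ ws) ts
  remove-t [] _ _ = []
  remove-t (u ∷ ts) (t≢u ∷ t∉ts) (u∈ ∷ ts⊆) with ∈-++⁻ vs u∈
  ... | inj₁ u∈vs = ∈-++⁺ˡ u∈vs ∷ remove-t ts t∉ts ts⊆
  ... | inj₂ (here refl) = ⊥-elim (t≢u refl)
  ... | inj₂ (there u∈ws) = ∈-++⁺ʳ vs u∈ws ∷ remove-t ts t∉ts ts⊆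

Bits : Set
Bits = List Bool

totalLength : List Bits → ℕ
totalLength xs = sum (map length xs)

countEmpty : List Bits → ℕ
countEmpty [] = 0
countEmpty ([] ∷ xs) = suc (countEmpty xs)
countEmpty ((_ ∷ _) ∷ xs) = countEmpty xs

branch : Bool → List Bits → List Bits
branch b [] = []
branch b ([] ∷ xs) = branch b xs
branch b ((c ∷ s) ∷ xs) with b ≟ c
... | yes _ = s ∷ branch b xs
... | no _ = branch b xs

length-branches : ∀ xs →
  length xs ≡ countEmpty xs + length (branch false xs) + length (branch true xs)
length-branches [] = refl
length-branches ([] ∷ xs) = cong suc (length-branches xs)
length-branches ((false ∷ s) ∷ xs) =
  trans (cong suc (length-branches xs)) (cong (_+ length (branch true xs)) (sym (+-suc (countEmpty xs) _)))
length-branches ((true ∷ s) ∷ xs) =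
  trans (cong suc (length-branches xs)) (sym (+-suc (countEmpty xs + _) _))

module BranchLengths (xs : List Bits) where
  lf Tf lt Tt : ℕ
  lf = length (branch false xs)
  Tf = totalLength (branch false xs)
  lt = length (branch true xs)
  Tt = totalLength (branch true xs)

totalLength-branches : ∀ xs → totalLength xs ≡
  length (branch false xs) + totalLength (branch false xs) + (length (branch true xs) + totalLength (branch true xs))
totalLength-branches [] = refl
totalLength-branches ([] ∷ xs) = totalLength-branches xs
totalLength-branches ((false ∷ s) ∷ xs) rewrite totalLength-branches xs =
  cong suc (trans (sym (+-assoc (length s) (lf + Tf) (lt + Tt))) (cong (_+ (lt + Tt)) (x∙yz≈y∙xz (length s) lf Tf)))
  where open BranchLengths xs
totalLength-branches ((true ∷ s) ∷ xs) rewrite totalLength-branches xs =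
  trans (cong suc (trans (x∙yz≈y∙xz (length s) (lf + Tf) (lt + Tt)) (cong (lf + Tf +_) (x∙yz≈y∙xz (length s) lt Tt))))
        (sym (+-suc (lf + Tf) (lt + (length s + Tt))))
  where open BranchLengths xs

unique⇒countEmpty≤1 : ∀ xs → Unique xs → countEmpty xs ≤ 1
unique⇒countEmpty≤1 [] _ = z≤n
unique⇒countEmpty≤1 ([] ∷ xs) ([]∉xs ∷ _) = s≤s (≤-reflexive (no-empty xs []∉xs))
  where
  no-empty : ∀ xs → All ([] ≢_) xs → countEmpty xs ≡ 0
  no-empty [] _ = refl
  no-empty ([] ∷ xs) ([]≢[] ∷ _) = ⊥-elim ([]≢[] refl)
  no-empty ((_ ∷ _) ∷ xs) (_ ∷ []∉xs) = no-empty xs []∉xs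
unique⇒countEmpty≤1 ((_ ∷ _) ∷ xs) (_ ∷ xs!) = unique⇒countEmpty≤1 xs xs!

branch-unique : ∀ b xs → Unique xs → Unique (branch b xs)
branch-unique b [] _ = []
branch-unique b ([] ∷ xs) (_ ∷ xs!) = branch-unique b xs xs!
branch-unique b ((c ∷ s) ∷ xs) (cs∉xs ∷ xs!) with b ≟ c
... | yes refl = branch-∉ xs cs∉xs ∷ branch-unique b xs xs!
  where
  branch-∉ : ∀ xs → All ((b ∷ s) ≢_) xs → All (s ≢_) (branch b xs)
  branch-∉ [] _ = []
  branch-∉ ([] ∷ xs) (_ ∷ bs∉xs) = branch-∉ xs bs∉xs
  branch-∉ ((c ∷ t) ∷ xs) (bs≢ct ∷ bs∉xs) with b ≟ c
  ... | yes refl = (λ s≡t → bs≢ct (cong (b ∷_) s≡t)) ∷ branch-∉ xs bs∉xs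
  ... | no _ = branch-∉ xs bs∉xs
... | no _ = branch-unique b xs xs!

n<2^n : ∀ n → n < 2 ^ n
n<2^n zero = s≤s z≤n
n<2^n (suc n) = begin-strict
  suc n        <⟨ s≤s (n<2^n n) ⟩
  1 + 2 ^ n    ≡⟨ +-comm 1 (2 ^ n) ⟩
  2 ^ n + 1    ≤⟨ +-monoʳ-≤ (2 ^ n) (≤-trans (m^n>0 2 n) (m≤m+n (2 ^ n) 0)) ⟩
  2 ^ n + (2 ^ n + 0) ∎
  where open ≤-Reasoning

trie-step : ∀ k e a b La Lb P → e ≤ 1 → suc k ≤ P → k * a ≤ La + k * P → k * b ≤ Lb + k * P →
            suc k * (e + a + b) ≤ a + La + (b + Lb) + suc k * (2 * P)
trie-step k e a b La Lb P e≤1 k<P ka≤ kb≤ = begin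
  suc k * (e + a + b)                          ≤⟨ *-monoʳ-≤ (suc k) (+-monoˡ-≤ b (+-monoˡ-≤ a e≤1)) ⟩
  suc k * (1 + a + b)                          ≡⟨ expand k a b ⟩
  suc k + (a + k * a) + (b + k * b)            ≤⟨ +-mono-≤ (+-mono-≤ k<P (+-monoʳ-≤ a ka≤)) (+-monoʳ-≤ b kb≤) ⟩
  P + (a + (La + k * P)) + (b + (Lb + k * P))  ≡⟨ collect k a b La Lb P ⟩
  a + La + (b + Lb) + (P + k * (2 * P))        ≤⟨ +-monoʳ-≤ (a + La + (b + Lb)) (+-monoˡ-≤ (k * (2 * P)) (m≤m+n P (P + 0))) ⟩
  a + La + (b + Lb) + suc k * (2 * P)          ∎
  where
  open ≤-Reasoning
  expand : ∀ k a b → suc k * (1 + a + b) ≡ suc k + (a + k * a) + (b + k * b)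
  expand = solve-∀
  collect : ∀ k a b La Lb P →
            P + (a + (La + k * P)) + (b + (Lb + k * P)) ≡ a + La + (b + Lb) + (P + k * (2 * P))
  collect = solve-∀

trie-bound : ∀ k xs → Unique xs → k * length xs ≤ totalLength xs + k * 2 ^ k
trie-bound zero xs _ = z≤n
trie-bound (suc k) xs xs! rewrite length-branches xs | totalLength-branches xs =
  trie-step k (countEmpty xs) _ _ _ _ (2 ^ k) (unique⇒countEmpty≤1 xs xs!) (n<2^n k)
    (trie-bound k (branch false xs) (branch-unique false xs xs!))
    (trie-bound k (branch true xs) (branch-unique true xs xs!))

2*⌊n/2⌋≤n : ∀ n → 2 * ⌊ n /2⌋ ≤ n
2*⌊n/2⌋≤n n = begin
  ⌊ n /2⌋ + (⌊ n /2⌋ + 0) ≡⟨ cong (⌊ n /2⌋ +_) (+-identityʳ ⌊ n /2⌋) ⟩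
  ⌊ n /2⌋ + ⌊ n /2⌋       ≤⟨ +-monoʳ-≤ ⌊ n /2⌋ (⌊n/2⌋≤⌈n/2⌉ n) ⟩
  ⌊ n /2⌋ + ⌈ n /2⌉       ≡⟨ ⌊n/2⌋+⌈n/2⌉≡n n ⟩
  n                       ∎
  where open ≤-Reasoning

2^⌊log₂n⌋≤n : ∀ n → 0 < n → 2 ^ ⌊log₂ n ⌋ ≤ n
2^⌊log₂n⌋≤n n = 2^k≤n ⌊log₂ n ⌋ n refl
  where
  2^k≤n : ∀ k n → ⌊log₂ n ⌋ ≡ k → 0 < n → 2 ^ k ≤ n
  2^k≤n zero n _ 0<n = 0<n
  2^k≤n (suc k) 1 () _
  2^k≤n (suc k) n@(suc (suc _)) log[n]≡1+k _ = begin
    2 * 2 ^ k    ≤⟨ *-monoʳ-≤ 2 (2^k≤n k ⌊ n /2⌋ log[n/2]≡k (s≤s z≤n)) ⟩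
    2 * ⌊ n /2⌋  ≤⟨ 2*⌊n/2⌋≤n n ⟩
    n            ∎
    where
    open ≤-Reasoning
    log[n/2]≡k : ⌊log₂ ⌊ n /2⌋ ⌋ ≡ k
    log[n/2]≡k = trans (⌊log₂⌊n/2⌋⌋≡⌊log₂n⌋∸1 n) (cong (_∸ 1) log[n]≡1+k)

⌊log₂n⌋≤n : ∀ n → ⌊log₂ n ⌋ ≤ n
⌊log₂n⌋≤n n = subst (⌊log₂ n ⌋ ≤_) (⌊log₂[2^n]⌋≡n n) (⌊log₂⌋-mono-≤ (<⇒≤ (n<2^n n)))

trie-bound⇒n*⌊log₂n⌋≤ : ∀ w L → (∀ k → k * w ≤ L + k * 2 ^ k) → w * ⌊log₂ w ⌋ ≤ w + 2 * L
trie-bound⇒n*⌊log₂n⌋≤ zero L _ = z≤n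
trie-bound⇒n*⌊log₂n⌋≤ w@(suc _) L trie with ⌊log₂ w ⌋ | 2^⌊log₂n⌋≤n w (s≤s z≤n)
... | zero | _ = ≤-trans (≤-reflexive (*-zeroʳ w)) z≤n
... | suc k | 2^[1+k]≤w = begin
  w * suc k  ≡⟨ *-suc w k ⟩
  w + w * k  ≡⟨ cong (w +_) (*-comm w k) ⟩
  w + k * w  ≤⟨ +-monoʳ-≤ w (+-cancelʳ-≤ (k * w) (k * w) (2 * L) double-bound) ⟩
  w + 2 * L  ∎
  where
  open ≤-Reasoning
  regroup : ∀ L k P → L + k * P + (L + k * P) ≡ 2 * L + k * (2 * P)
  regroup = solve-∀
  double-bound : k * w + k * w ≤ 2 * L + k * w
  double-bound = begin
    k * w + k * w                    ≤⟨ +-mono-≤ (trie k) (trie k) ⟩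
    L + k * 2 ^ k + (L + k * 2 ^ k)  ≡⟨ regroup L k (2 ^ k) ⟩
    2 * L + k * 2 ^ suc k            ≤⟨ +-monoʳ-≤ (2 * L) (*-monoʳ-≤ k 2^[1+k]≤w) ⟩
    2 * L + k * w                    ∎

unique-bits-bound : ∀ xs → Unique xs → length xs * ⌊log₂ length xs ⌋ ≤ length xs + 2 * totalLength xs
unique-bits-bound xs xs! = trie-bound⇒n*⌊log₂n⌋≤ (length xs) (totalLength xs) (λ k → trie-bound k xs xs!)

-- Balanced parentheses, with true for an opening and false for a closing bracket.
-- The continuation argument r makes injectivity provable by structural induction.
mutual
  encode : Tree → Bits → Bits
  encode (node ts) r = true ∷ encodes ts (false ∷ r)

  encodes : List Tree → Bits → Bits
  encodes [] r = r
  encodes (t ∷ ts) r = encode t (encodes ts r)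

mutual
  encode-injective : ∀ t u r s → encode t r ≡ encode u s → t ≡ u × r ≡ s
  encode-injective (node ts) (node us) r s eq with encodes-injective ts us r s (∷-injectiveʳ eq)
  ... | refl , refl = refl , refl

  encodes-injective : ∀ ts us r s → encodes ts (false ∷ r) ≡ encodes us (false ∷ s) → ts ≡ us × r ≡ s
  encodes-injective [] [] r s refl = refl , refl
  encodes-injective [] (node _ ∷ _) r s ()
  encodes-injective (node _ ∷ _) [] r s ()
  encodes-injective (t ∷ ts) (u ∷ us) r s eq with encode-injective t u _ _ eq
  ... | refl , eq′ with encodes-injective ts us r s eq′
  ... | refl , refl = refl , refl

mutual
  length-encode : ∀ t r → length (encode t r) ≡ 2 * size t + length r
  length-encode (node ts) r = trans (cong suc (length-encodes ts (false ∷ r))) (shift (sizes ts) (length r))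
    where
    shift : ∀ a b → suc (2 * a + suc b) ≡ 2 * suc a + b
    shift = solve-∀

  length-encodes : ∀ ts r → length (encodes ts r) ≡ 2 * sizes ts + length r
  length-encodes [] r = refl
  length-encodes (t ∷ ts) r = begin
    length (encode t (encodes ts r))        ≡⟨ length-encode t (encodes ts r) ⟩
    2 * size t + length (encodes ts r)      ≡⟨ cong (2 * size t +_) (length-encodes ts r) ⟩
    2 * size t + (2 * sizes ts + length r)  ≡⟨ sym (+-assoc (2 * size t) _ _) ⟩
    2 * size t + 2 * sizes ts + length r    ≡⟨ cong (_+ length r) (sym (*-distribˡ-+ 2 (size t) (sizes ts))) ⟩
    2 * sizes (t ∷ ts) + length r           ∎
    where open ≡-Reasoning

code : Tree → Bits
code t = encode t []

code-injective : ∀ {t u} → code t ≡ code u → t ≡ u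
code-injective {t} {u} eq = proj₁ (encode-injective t u [] [] eq)

totalLength-codes : ∀ ts → totalLength (map code ts) ≡ 2 * sizes ts
totalLength-codes [] = refl
totalLength-codes (t ∷ ts) = begin
  length (code t) + totalLength (map code ts) ≡⟨ cong₂ _+_ (trans (length-encode t []) (+-identityʳ _)) (totalLength-codes ts) ⟩
  2 * size t + 2 * sizes ts                   ≡⟨ sym (*-distribˡ-+ 2 (size t) (sizes ts)) ⟩
  2 * sizes (t ∷ ts)                          ∎
  where open ≡-Reasoning

unique-trees-bound : ∀ ts → Unique ts → length ts * ⌊log₂ length ts ⌋ ≤ 5 * sizes ts
unique-trees-bound ts ts! = begin
  w * ⌊log₂ w ⌋                                ≡⟨ cong (λ n → n * ⌊log₂ n ⌋) (sym (length-map code ts)) ⟩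
  length cs * ⌊log₂ length cs ⌋                ≤⟨ unique-bits-bound cs (Unique.map⁺ code-injective ts!) ⟩
  length cs + 2 * totalLength cs               ≡⟨ cong₂ (λ n L → n + 2 * L) (length-map code ts) (totalLength-codes ts) ⟩
  w + 2 * (2 * sizes ts)                       ≤⟨ +-monoˡ-≤ (2 * (2 * sizes ts)) (length≤sizes ts) ⟩
  sizes ts + 2 * (2 * sizes ts)                ≡⟨ five (sizes ts) ⟩
  5 * sizes ts                                 ∎
  where
  open ≤-Reasoning
  w = length ts
  cs = map code ts
  five : ∀ n → n + 2 * (2 * n) ≡ 5 * n
  five = solve-∀

wlogw≤2*n*⌊log₂n⌋ : ∀ n → wlogw n ≤ 2 * (n * ⌊log₂ n ⌋)
wlogw≤2*n*⌊log₂n⌋ n = begin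
  n * (⌊log₂ n ⌋ + ⌊log₂ ⌊log₂ n ⌋ ⌋) ≤⟨ *-monoʳ-≤ n (+-monoʳ-≤ ⌊log₂ n ⌋ (⌊log₂n⌋≤n ⌊log₂ n ⌋)) ⟩
  n * (⌊log₂ n ⌋ + ⌊log₂ n ⌋)         ≡⟨ double n ⌊log₂ n ⌋ ⟩
  2 * (n * ⌊log₂ n ⌋)                 ∎
  where
  open ≤-Reasoning
  double : ∀ n l → n * (l + l) ≡ 2 * (n * l)
  double = solve-∀

proposition2 : Σ ℕ λ C → ∀ (T : Tree) (w : ℕ) → Width T w → wlogw w ≤ C * size T
proposition2 = 10 , width-bound
  where
  width-bound : ∀ (T : Tree) (w : ℕ) → Width T w → wlogw w ≤ 10 * size T
  width-bound T _ ((d , _ , R , refl , R⊆level , R-non-isomorphic , _) , _) = begin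
    wlogw (length R)                      ≤⟨ wlogw≤2*n*⌊log₂n⌋ (length R) ⟩
    2 * (length R * ⌊log₂ length R ⌋)     ≤⟨ *-monoʳ-≤ 2 (unique-trees-bound R R!) ⟩
    2 * (5 * sizes R)                     ≤⟨ *-monoʳ-≤ 2 (*-monoʳ-≤ 5 sizes-R≤size-T) ⟩
    2 * (5 * size T)                      ≡⟨ sym (*-assoc 2 5 (size T)) ⟩
    10 * size T                           ∎
    where
    open ≤-Reasoning
    R! : Unique R
    R! = AllPairs.map ≇⇒≢ R-non-isomorphic
    sizes-R≤size-T : sizes R ≤ size T
    sizes-R≤size-T = ≤-trans (unique-⊆⇒sizes≤ R (atLevel d T) R! R⊆level) (sizes-atDepth≤size (depth T ∸ d) T)
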